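{- Let $N$ be a net, $i\ge 0$, $\pi$ a $(k,n)$-incomplete path of $N$ with at least $k+i$ transitions, and $w$ a witness of the $(k,n)$-incompleteness of $\pi$. Then $\pi\oplus_{k+i}w$ (which is a path of $N$) is less incomplete than $\pi$.
   Context: Actions $Act=H\uplus O\uplus\{\tau\}$; actions in $O\cup\{\tau\}$ are non-blocking. Multisets over $X$ are functions $X\to\mathbb N$ with pointwise $\le$, $+$, $-$, $\cap$. A labelled Petri net is $N=(S,T,F,M_0,\ell)$ with places $S$, transitions $T$ (disjoint), $F:(S\times T)\cup(T\times S)\to\mathbb N$, initial marking $M_0$, labelling $\ell:T\to Act$. ${}^\bullet u(s)=F(s,u)$, $u^\bullet(s)=F(u,s)$; $M[u\rangle$ iff ${}^\bullet u\le M$, giving $M[u\rangle M'$ with $M'=M-{}^\bullet u+u^\bullet$. A path is $M_0u_1M_1u_2\dots$ starting at the initial marking, infinite or ending in a marking, with $M_k[u_{k+1}\rangle M_{k+1}$; markings on paths are reachable. A net means a structural conflict net (${}^\bullet u+{}^\bullet v\le M$ implies ${}^\bullet u\cap{}^\bullet v=\emptyset$ for reachable $M$) with ${}^\bullet u\neq\emptyset$ for all $u$ and all reachable markings finite. A firing sequence is the sequence of transitions $\mathrm{fs}(\pi)$ of a path $\pi$; conversely $\mathrm{ph}(\sigma)$ is the path of firing sequence $\sigma$. For $\sigma=u_1u_2\dots$ with at least $k$ transitions, $\sigma\oplus_k w=u_1\dots u_kwu_{k+1}\dots$, and $\pi\oplus_kw:=\mathrm{ph}(\mathrm{fs}(\pi)\oplus_kw)$.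 On $\pi=M_0u_1M_1\dots$, transition $v$ is continuously enabled from position $k$ onwards if $M_k[v\rangle$ and ${}^\bullet v\cap{}^\bullet u_i=\emptyset$ for all $i>k$. A path $\pi$ is $(k,n)$-incomplete if $k$ is the smallest number such that there is a transition $w$ with $\ell(w)\in O\cup\{\tau\}$ (a witness) continuously enabled on $\pi$ from position $k$ onwards, and $n$ is the number of places $s$ with $s\in{}^\bullet w$ for some witness $w$ of the $(k,n)$-incompleteness; a path with no such $k$ is called $(\infty,0)$-incomplete. If $\pi$ is $(k,n)$-incomplete and $\rho$ is $(h,m)$-incomplete, $\rho$ is less incomplete than $\pi$ if $\rho$ has the same prefix up to position $k$ as $\pi$ and either $h>k$, or $h=k$ and $m<n$. -}

module Defs where

open import Level using (Level; _⊔_) renaming (suc to lsuc)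
open import Data.Nat using (ℕ; zero; suc; _+_; _∸_; _≤_; _<_; _>_)
open import Data.Maybe using (Maybe; just; nothing)
open import Data.Product using (Σ; ∃; _×_; _,_)
open import Data.Sum using (_⊎_)
open import Data.List using (List; length)
open import Data.List.Membership.Propositional using (_∈_)
open import Data.List.Relation.Unary.Unique.Propositional using (Unique)
open import Relation.Nullary using (¬_)
open import Relation.Binary.PropositionalEquality using (_≡_)
open import Data.Nat using (_<ᵇ_; _≡ᵇ_)
open import Data.Bool using (if_then_else_)

data Act (H O : Set) : Set where
  hidden : H → Act H O
  output : O → Act H O
  τ      : Act H O

data NonBlocking {H O : Set} : Act H O → Set where
  nb-output : (o : O) → NonBlocking (output o)
  nb-τ      : NonBlocking τ

Multiset : Set → Set
Multiset X = X → ℕ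

_≤ₘ_ : {X : Set} → Multiset X → Multiset X → Set
A ≤ₘ B = ∀ x → A x ≤ B x

_+ₘ_ : {X : Set} → Multiset X → Multiset X → Multiset X
(A +ₘ B) x = A x + B x

_-ₘ_ : {X : Set} → Multiset X → Multiset X → Multiset X
(A -ₘ B) x = A x ∸ B x

Disjoint : {X : Set} → Multiset X → Multiset X → Set
Disjoint A B = ∀ x → ¬ (0 < A x × 0 < B x)

_∈ₘ_ : {X : Set} → X → Multiset X → Set
x ∈ₘ A = 0 < A x

HasCard : {X : Set} → (X → Set) → ℕ → Set
HasCard {X} P n = Σ (List X) λ L → Unique L × (∀ x → (x ∈ L → P x) × (P x → x ∈ L)) × length L ≡ n

FiniteMS : {X : Set} → Multiset X → Set
FiniteMS {X} A = Σ (List X) λ L → ∀ x → 0 < A x → x ∈ L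

-- Labelled Petri nets  N = (S, T, F, M₀, ℓ);  F split into pre/post

record PetriNet (H O : Set) : Set₁ where
  field
    S    : Set
    T    : Set
    pre  : T → Multiset S
    post : T → Multiset S
    M₀   : Multiset S
    ℓ    : T → Act H O

module _ {H O : Set} (N : PetriNet H O) where
  open PetriNet N

  Enabled : Multiset S → T → Set
  Enabled M u = pre u ≤ₘ M

  fire : Multiset S → T → Multiset S
  fire M u = (M -ₘ pre u) +ₘ post u

  -- A (possibly infinite) sequence of transitions, 0-indexed:
  -- σ j = just u_{j+1};  nothing means the sequence has ended.
  Seq : Set
  Seq = ℕ → Maybe T

  marking : Seq → ℕ → Multiset S
  marking σ zero = M₀
  marking σ (suc k) with σ k
  ... | just u  = fire (marking σ k) u
  ... | nothing = marking σ k

  AtLeast : Seq → ℕ → Set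
  AtLeast σ k = ∀ j → j < k → Σ T λ u → σ j ≡ just u

  -- σ is a firing sequence, i.e. σ = fs(π) for a path π = ph(σ)
  IsPath : Seq → Set
  IsPath σ = (∀ j → σ j ≡ nothing → σ (suc j) ≡ nothing)
           × (∀ j u → σ j ≡ just u → Enabled (marking σ j) u)

  Reachable : Multiset S → Set
  Reachable M = Σ Seq λ σ → IsPath σ × Σ ℕ λ k → AtLeast σ k × (∀ s → marking σ k s ≡ M s)

  IsNet : Set
  IsNet = (∀ M → Reachable M → ∀ u v → (pre u +ₘ pre v) ≤ₘ M → Disjoint (pre u) (pre v))
        × (∀ u → Σ S λ s → s ∈ₘ pre u)
        × (∀ M → Reachable M → FiniteMS M)

  insertAt : Seq → ℕ → T → Seq
  insertAt σ k w j = if j <ᵇ k then σ j else (if j ≡ᵇ k then just w else σ (j ∸ 1))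

  ContEnabled : Seq → ℕ → T → Set
  ContEnabled σ k v = Enabled (marking σ k) v
                    × (∀ j u → k ≤ j → σ j ≡ just u → Disjoint (pre v) (pre u))

  WitnessAt : Seq → ℕ → T → Set
  WitnessAt σ k w = NonBlocking (ℓ w) × ContEnabled σ k w

  Incomplete : Seq → ℕ → ℕ → Set
  Incomplete σ k n = (Σ T λ w → WitnessAt σ k w)
                   × (∀ k′ → k′ < k → ∀ w → ¬ WitnessAt σ k′ w)
                   × HasCard (λ s → Σ T λ w → WitnessAt σ k w × s ∈ₘ pre w) n

  InfIncomplete : Seq → Set
  InfIncomplete σ = ∀ k w → ¬ WitnessAt σ k w

  -- ρ is less incomplete than π, where π is (k,n)-incomplete:
  -- same prefix up to position k, and whatever incompleteness (h,m) ρ has,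
  -- h > k (including h = ∞), or h = k and m < n.
  LessIncomplete : Seq → Seq → ℕ → ℕ → Set
  LessIncomplete ρ π k n = (∀ j → j < k → ρ j ≡ π j)
                         × (∀ h m → Incomplete ρ h m → h > k ⊎ (h ≡ k × m < n))

module Submission where

open import Defs
open import Data.Nat using (ℕ; _+_)
open import Data.Product using (_×_)

open import Data.Bool using (true; false)
open import Data.Empty using (⊥-elim)
open import Data.Maybe using (Maybe; just; nothing)
open import Data.Nat using (zero; suc; _∸_; _≤_; _<_; _>_; _≤′_; ≤′-refl; ≤′-step; z≤n; s≤s; _<ᵇ_; _≡ᵇ_; _<?_)
open import Data.Nat.Properties
open import Data.Product using (Σ; _,_; proj₁; proj₂)
open import Data.Sum using (_⊎_; inj₁; inj₂)
open import Data.List using (List; []; _∷_; length)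
open import Data.List.Membership.Propositional using (_∈_)
open import Data.List.Relation.Unary.Any using (here; there)
import Data.List.Relation.Unary.All as All
open import Data.List.Relation.Unary.AllPairs using (_∷_)
open import Data.List.Relation.Unary.Unique.Propositional using (Unique)
open import Relation.Binary using (tri<; tri≈; tri>)
open import Relation.Binary.PropositionalEquality
open import Relation.Nullary using (¬_; yes; no; contradiction)
open import Relation.Nullary.Reflects using (ofʸ; ofⁿ)

-- Let ρ = π ⊕_K w with K = k + i, where w is a witness of the (k,n)-incompleteness
-- of π.  The proof rests on one fact of token arithmetic: a transition whose preset
-- is disjoint from that of u stays enabled when u fires, and two enabled transitions
-- with disjoint presets can be fired in either order.  Since w is continuously
-- enabled from k, it is enabled at every later position and its preset is disjoint
-- from every later transition of π; hence below K the markings of ρ and π coincide,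
-- and beyond K the marking of ρ is that of π with w fired, so ρ is again a path.
-- For incompleteness, a witness of ρ at a position h ≤ K is a witness of π at h
-- (ρ only adds w), so ρ has no witness before k; and every witness of ρ at k is a
-- witness of π at k whose preset avoids that of w, which is nonempty.  So the set
-- of witness places at k strictly shrinks, by a counting lemma on duplicate-free
-- lists.

module _ {X : Set} where

  remove : (ys : List X) {x : X} → x ∈ ys → List X
  remove (_ ∷ ys) (here _)  = ys
  remove (y ∷ ys) (there p) = y ∷ remove ys p

  length-remove : (ys : List X) {x : X} (p : x ∈ ys) → length ys ≡ suc (length (remove ys p))
  length-remove (_ ∷ ys) (here _)  = refl
  length-remove (y ∷ ys) (there p) = cong suc (length-remove ys p)

  ∈-remove : (ys : List X) {x z : X} (p : x ∈ ys) → z ∈ ys → z ≢ x → z ∈ remove ys p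
  ∈-remove (_ ∷ ys) (here x≡y)  (here z≡y) z≢x = contradiction (trans z≡y (sym x≡y)) z≢x
  ∈-remove (_ ∷ ys) (here _)    (there q)  _   = q
  ∈-remove (y ∷ ys) (there p)   (here z≡y) _   = here z≡y
  ∈-remove (y ∷ ys) (there p)   (there q)  z≢x = there (∈-remove ys p q z≢x)

  unique-⊂-shorter : (xs ys : List X) → Unique xs → (∀ x → x ∈ xs → x ∈ ys) →
                     (y : X) → y ∈ ys → ¬ y ∈ xs → length xs < length ys
  unique-⊂-shorter [] (_ ∷ _) _ _ _ _ _ = s≤s z≤n
  unique-⊂-shorter (x ∷ xs) ys (x∉xs ∷ unique) xs⊆ys y y∈ys y∉xs =
    subst (suc (length xs) <_) (sym (length-remove ys x∈ys))
      (s≤s (unique-⊂-shorter xs (remove ys x∈ys) unique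
        (λ z z∈xs → ∈-remove ys x∈ys (xs⊆ys z (there z∈xs)) (λ z≡x → All.lookup x∉xs z∈xs (sym z≡x)))
        y (∈-remove ys x∈ys y∈ys (λ y≡x → y∉xs (here y≡x))) (λ y∈xs → y∉xs (there y∈xs))))
    where x∈ys = xs⊆ys x (here refl)

  hasCard-< : {P Q : X → Set} {m n : ℕ} → HasCard Q m → HasCard P n →
              (∀ x → Q x → P x) → (x : X) → P x → ¬ Q x → m < n
  hasCard-< (LQ , uniqueQ , listsQ , refl) (LP , _ , listsP , refl) Q⊆P x Px ¬Qx =
    unique-⊂-shorter LQ LP uniqueQ
      (λ z z∈LQ → proj₂ (listsP z) (Q⊆P z (proj₁ (listsQ z) z∈LQ)))
      x (proj₂ (listsP x) Px) (λ x∈LQ → ¬Qx (proj₁ (listsQ x) x∈LQ))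

-- Token arithmetic at a single place holding a tokens, where one transition consumes b
-- and produces c, the other consumes d and produces e, and not both b and d are positive.

disjoint-∸-+-≤ : (a b d e : ℕ) → b ≤ a → ¬ (0 < b × 0 < d) → b ≤ (a ∸ d) + e
disjoint-∸-+-≤ a zero    d       e _   _    = z≤n
disjoint-∸-+-≤ a (suc b) zero    e b≤a _    = ≤-trans b≤a (m≤m+n a e)
disjoint-∸-+-≤ a (suc b) (suc d) e _   both = contradiction (s≤s z≤n , s≤s z≤n) both

disjoint-∸-+-comm : (a b c d e : ℕ) → b ≤ a → d ≤ a → ¬ (0 < b × 0 < d) →
                    ((a ∸ b) + c ∸ d) + e ≡ ((a ∸ d) + e ∸ b) + c
disjoint-∸-+-comm a zero c d e _ d≤a _ = begin
  (a + c ∸ d) + e   ≡⟨ cong (_+ e) (+-∸-comm c d≤a) ⟩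
  (a ∸ d + c) + e   ≡⟨ +-assoc (a ∸ d) c e ⟩
  a ∸ d + (c + e)   ≡⟨ cong (a ∸ d +_) (+-comm c e) ⟩
  a ∸ d + (e + c)   ≡⟨ sym (+-assoc (a ∸ d) e c) ⟩
  (a ∸ d + e) + c   ∎
  where open ≡-Reasoning
disjoint-∸-+-comm a (suc b) c zero e b≤a _ _ = begin
  (a ∸ suc b + c) + e   ≡⟨ +-assoc (a ∸ suc b) c e ⟩
  a ∸ suc b + (c + e)   ≡⟨ cong (a ∸ suc b +_) (+-comm c e) ⟩
  a ∸ suc b + (e + c)   ≡⟨ sym (+-assoc (a ∸ suc b) e c) ⟩
  (a ∸ suc b + e) + c   ≡⟨ cong (_+ c) (sym (+-∸-comm e b≤a)) ⟩
  (a + e ∸ suc b) + c   ∎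
  where open ≡-Reasoning
disjoint-∸-+-comm a (suc b) c (suc d) e _ _ both = contradiction (s≤s z≤n , s≤s z≤n) both

disjoint-sym : {X : Set} {A B : Multiset X} → Disjoint A B → Disjoint B A
disjoint-sym A∩B s (0<Bs , 0<As) = A∩B s (0<As , 0<Bs)

module Net {H O : Set} (N : PetriNet H O) where
  open PetriNet N

  fire-preserves-enabled : ∀ {M u v} → Enabled N M v → Disjoint (pre v) (pre u) →
                           Enabled N (fire N M u) v
  fire-preserves-enabled {M} {u} {v} v-enabled v∩u s =
    disjoint-∸-+-≤ (M s) (pre v s) (pre u s) (post u s) (v-enabled s) (v∩u s)

  fire-commute : ∀ {M u v} → Enabled N M u → Enabled N M v → Disjoint (pre u) (pre v) →
                 fire N (fire N M u) v ≗ fire N (fire N M v) u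
  fire-commute {M} {u} {v} u-enabled v-enabled u∩v s =
    disjoint-∸-+-comm (M s) (pre u s) (post u s) (pre v s) (post v s)
                      (u-enabled s) (v-enabled s) (u∩v s)

  step : Multiset S → Maybe T → Multiset S
  step M (just u) = fire N M u
  step M nothing  = M

  marking-suc : ∀ σ j → marking N σ (suc j) ≡ step (marking N σ j) (σ j)
  marking-suc σ j with σ j
  ... | just u  = refl
  ... | nothing = refl

  step-cong : ∀ {M M′} → M ≗ M′ → ∀ x → step M x ≗ step M′ x
  step-cong M≗M′ (just u) s = cong (λ a → a ∸ pre u s + post u s) (M≗M′ s)
  step-cong M≗M′ nothing  s = M≗M′ s

  step-preserves-enabled : ∀ {M v} x → Enabled N M v →
                           (∀ u → x ≡ just u → Disjoint (pre v) (pre u)) →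
                           Enabled N (step M x) v
  step-preserves-enabled (just u) v-enabled disjoint = fire-preserves-enabled v-enabled (disjoint u refl)
  step-preserves-enabled nothing  v-enabled _        = v-enabled

  step-fire-commute : ∀ {M w} x → Enabled N M w →
                      (∀ u → x ≡ just u → Enabled N M u × Disjoint (pre w) (pre u)) →
                      step (fire N M w) x ≗ fire N (step M x) w
  step-fire-commute (just u) w-enabled independent =
    fire-commute w-enabled (proj₁ (independent u refl)) (proj₂ (independent u refl))
  step-fire-commute nothing _ _ s = refl

  marking-agree : ∀ {σ σ′ K} → (∀ j → j < K → σ j ≡ σ′ j) →
                  ∀ j → j ≤ K → marking N σ j ≡ marking N σ′ j
  marking-agree agree zero    _   = refl
  marking-agree {σ} {σ′} agree (suc j) j<K = begin
    marking N σ (suc j)            ≡⟨ marking-suc σ j ⟩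
    step (marking N σ j) (σ j)     ≡⟨ cong₂ step (marking-agree agree j (<⇒≤ j<K)) (agree j j<K) ⟩
    step (marking N σ′ j) (σ′ j)   ≡⟨ sym (marking-suc σ′ j) ⟩
    marking N σ′ (suc j)           ∎
    where open ≡-Reasoning

  contEnabled⇒enabled : ∀ {σ k v j} → ContEnabled N σ k v → k ≤′ j → Enabled N (marking N σ j) v
  contEnabled⇒enabled (v-enabled , _) ≤′-refl = v-enabled
  contEnabled⇒enabled {σ} {v = v} {j = suc j} cont (≤′-step k≤′j) =
    subst (λ M → Enabled N M v) (sym (marking-suc σ j))
      (step-preserves-enabled (σ j) (contEnabled⇒enabled cont k≤′j)
        (λ u σj≡u → proj₂ cont j u (≤′⇒≤ k≤′j) σj≡u))

  contEnabled-later : ∀ {σ k v j} → ContEnabled N σ k v → k ≤ j → ContEnabled N σ j v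
  contEnabled-later cont k≤j =
    contEnabled⇒enabled cont (≤⇒≤′ k≤j) ,
    λ j′ u j≤j′ σj′≡u → proj₂ cont j′ u (≤-trans k≤j j≤j′) σj′≡u

  module Insertion (π : Seq N) (K : ℕ) (w : T) where

    ρ : Seq N
    ρ = insertAt N π K w

    insertAt-before : ∀ j → j < K → ρ j ≡ π j
    insertAt-before j j<K with j <ᵇ K | <ᵇ-reflects-< j K
    ... | true  | _       = refl
    ... | false | ofⁿ j≮K = contradiction j<K j≮K

    insertAt-at : ρ K ≡ just w
    insertAt-at with K <ᵇ K | <ᵇ-reflects-< K K | K ≡ᵇ K | ≡⇒≡ᵇ K K refl
    ... | true  | ofʸ K<K | _    | _ = contradiction K<K (<-irrefl refl)
    ... | false | _       | true | _ = refl

    insertAt-after : ∀ j → K ≤ j → ρ (suc j) ≡ π j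
    insertAt-after j K≤j with suc j <ᵇ K | <ᵇ-reflects-< (suc j) K | suc j ≡ᵇ K | ≡ᵇ⇒≡ (suc j) K
    ... | true  | ofʸ j<K | _     | _       = contradiction (≤-trans K≤j (n≤1+n j)) (<⇒≱ j<K)
    ... | false | _       | true  | j+1≡K   = contradiction (subst (_≤ j) (sym (j+1≡K _)) K≤j) 1+n≰n
    ... | false | _       | false | _       = refl

    marking-before : ∀ j → j ≤ K → marking N ρ j ≡ marking N π j
    marking-before = marking-agree insertAt-before

    -- Below K, ρ only adds w to π, so a witness of ρ at h ≤ K is a witness of π at h.
    witness-transfer : ∀ {h v} → h ≤ K → WitnessAt N ρ h v → WitnessAt N π h v
    witness-transfer {h} {v} h≤K (nonblocking , v-enabled , disjointρ) =
      nonblocking , subst (λ M → Enabled N M v) (marking-before h h≤K) v-enabled , disjointπ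
      where
      disjointπ : ∀ j u → h ≤ j → π j ≡ just u → Disjoint (pre v) (pre u)
      disjointπ j u h≤j πj≡u with j <? K
      ... | yes j<K = disjointρ j u h≤j (trans (insertAt-before j j<K) πj≡u)
      ... | no  j≮K = disjointρ (suc j) u (m≤n⇒m≤1+n h≤j) (trans (insertAt-after j (≮⇒≥ j≮K)) πj≡u)

    module _ (path : IsPath N π) (w-cont : ContEnabled N π K w) where

      marking-after : ∀ {j} → K ≤′ j → marking N ρ (suc j) ≗ fire N (marking N π j) w
      marking-after ≤′-refl = cong-app (begin
        marking N ρ (suc K)          ≡⟨ marking-suc ρ K ⟩
        step (marking N ρ K) (ρ K)   ≡⟨ cong₂ step (marking-before K ≤-refl) insertAt-at ⟩
        fire N (marking N π K) w     ∎)
        where open ≡-Reasoning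
      marking-after {suc j} (≤′-step K≤′j) s = begin
        marking N ρ (suc (suc j)) s               ≡⟨ cong-app (marking-suc ρ (suc j)) s ⟩
        step (marking N ρ (suc j)) (ρ (suc j)) s  ≡⟨ cong (λ x → step (marking N ρ (suc j)) x s) (insertAt-after j K≤j) ⟩
        step (marking N ρ (suc j)) (π j) s        ≡⟨ step-cong (marking-after K≤′j) (π j) s ⟩
        step (fire N (marking N π j) w) (π j) s   ≡⟨ step-fire-commute (π j) (contEnabled⇒enabled w-cont K≤′j) independent s ⟩
        fire N (step (marking N π j) (π j)) w s   ≡⟨ cong (λ M → fire N M w s) (sym (marking-suc π j)) ⟩
        fire N (marking N π (suc j)) w s          ∎
        where
        open ≡-Reasoning
        K≤j = ≤′⇒≤ K≤′j
        independent : ∀ u → π j ≡ just u → Enabled N (marking N π j) u × Disjoint (pre w) (pre u)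
        independent u πj≡u = proj₂ path j u πj≡u , proj₂ w-cont j u K≤j πj≡u

      -- ρ is a path: it ends only where π ends, and each transition is enabled, after K
      -- because its preset is disjoint from that of w.
      insertAt-isPath : AtLeast N π K → IsPath N ρ
      insertAt-isPath long = ends , enabled
        where
        ends : ∀ j → ρ j ≡ nothing → ρ (suc j) ≡ nothing
        ends j ρj≡nothing with <-cmp j K
        ... | tri< j<K _ _ with long j j<K
        ...   | u , πj≡u with () ← trans (sym πj≡u) (trans (sym (insertAt-before j j<K)) ρj≡nothing)
        ends j ρj≡nothing | tri≈ _ refl _ with () ← trans (sym insertAt-at) ρj≡nothing
        ends (suc j) ρj≡nothing | tri> _ _ (s≤s K≤j) =
          trans (insertAt-after (suc j) (m≤n⇒m≤1+n K≤j))
                (proj₁ path j (trans (sym (insertAt-after j K≤j)) ρj≡nothing))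

        enabled : ∀ j u → ρ j ≡ just u → Enabled N (marking N ρ j) u
        enabled j u ρj≡u with <-cmp j K
        ... | tri< j<K _ _ =
          subst (λ M → Enabled N M u) (sym (marking-before j (<⇒≤ j<K)))
                (proj₂ path j u (trans (sym (insertAt-before j j<K)) ρj≡u))
        ... | tri≈ _ refl _ with refl ← trans (sym insertAt-at) ρj≡u =
          subst (λ M → Enabled N M w) (sym (marking-before K ≤-refl)) (proj₁ w-cont)
        enabled (suc j) u ρj≡u | tri> _ _ (s≤s K≤j) = λ s →
          subst (pre u s ≤_) (sym (marking-after (≤⇒≤′ K≤j) s))
            (fire-preserves-enabled (proj₂ path j u πj≡u)
              (disjoint-sym (proj₂ w-cont j u K≤j πj≡u)) s)
          where πj≡u = trans (sym (insertAt-after j K≤j)) ρj≡u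

    -- Inserting a witness w of the (k,n)-incompleteness of π at K ≥ k makes the sequence less
    -- incomplete: no witness appears before k, and the witness places at k lose those of w.
    insertAt-lessIncomplete : (∀ u → Σ S λ s → s ∈ₘ pre u) → ∀ {k n} → k ≤ K →
                              Incomplete N π k n → WitnessAt N π k w → LessIncomplete N ρ π k n
    insertAt-lessIncomplete nonempty {k} {n} k≤K (_ , minimal , placesπ) w-witness =
      (λ j j<k → insertAt-before j (<-≤-trans j<k k≤K)) , compare
      where
      s₀ = proj₁ (nonempty w)
      s₀∈•w = proj₂ (nonempty w)

      fewer-places : ∀ {m} → HasCard (λ s → Σ T λ v → WitnessAt N ρ k v × s ∈ₘ pre v) m → m < n
      fewer-places placesρ =
        hasCard-< placesρ placesπ
          (λ s (v , v-witness , s∈•v) → v , witness-transfer k≤K v-witness , s∈•v)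
          s₀ (w , w-witness , s₀∈•w)
          (λ (v , v-witness , s₀∈•v) → proj₂ (proj₂ v-witness) K w k≤K insertAt-at s₀ (s₀∈•v , s₀∈•w))

      compare : ∀ h m → Incomplete N ρ h m → h > k ⊎ (h ≡ k × m < n)
      compare h m ((v , v-witness) , _ , placesρ) with <-cmp h k
      ... | tri< h<k _ _ = ⊥-elim (minimal h h<k v (witness-transfer (≤-trans (<⇒≤ h<k) k≤K) v-witness))
      ... | tri≈ _ refl _ = inj₂ (refl , fewer-places placesρ)
      ... | tri> _ _ k<h = inj₁ k<h

lemma2 : {H O : Set} (N : PetriNet H O) → IsNet N →
         (i k n : ℕ) (π : Seq N) → IsPath N π → Incomplete N π k n →
         AtLeast N π (k + i) →
         (w : PetriNet.T N) → WitnessAt N π k w →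
         IsPath N (insertAt N π (k + i) w)
         × LessIncomplete N (insertAt N π (k + i) w) π k n
lemma2 N (_ , nonempty-presets , _) i k n π path incomplete long w w-witness =
  insertAt-isPath path (contEnabled-later (proj₂ w-witness) k≤K) long ,
  insertAt-lessIncomplete nonempty-presets k≤K incomplete w-witness
  where
  open Net N
  open Insertion π (k + i) w
  k≤K : k ≤ k + i
  k≤K = m≤m+n k i
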